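{- Let $P$ be a finite $\varepsilon$-consistent poset and let $G$ be a subgroup of $\mathrm{Aut}(P,\varepsilon)$. Then there is a bijection between the set of all saturations of $(P/G,\overline\varepsilon)$ and the set of those saturations $(Q,\delta)$ of $(P,\varepsilon)$ such that $G\subseteq\mathrm{Aut}(Q,\delta)$.
   Context: All posets are finite; $E(P)$ is the set of covering relations. An edge labeling is $\varepsilon\colon E(P)\to\{ -1,1\}$; for a saturated chain $\mathcal{C}\colon p_0\lessdot\cdots\lessdot p_m$, $\varepsilon(\mathcal{C})=\sum_i\varepsilon(p_i\lessdot p_{i+1})$. $P$ is $\varepsilon$-consistent if for every $y$ the quantity $\varepsilon(\mathcal{C})$ is the same for all maximal saturated chains $\mathcal{C}$ of $P_{\le y}$; this value is the rank $\rho_P(y)$. $\mathrm{Aut}(P,\varepsilon)$: automorphisms $\psi$ of $P$ with $\varepsilon(\psi(p)\lessdot\psi(q))=\varepsilon(p\lessdot q)$ for all covers. The quotient poset $P/G$ is the set of $G$-orbits with $\mathcal{O}\le\mathcal{O}'$ iff $p\le p'$ for some $p\in\mathcal{O}$, $p'\in\mathcal{O}'$; the labeling $\overline\varepsilon(\mathcal{O}\lessdot\mathcal{O}')=\varepsilon(p\lessdot p')$ for any $p\in\mathcal{O},p'\in\mathcal{O}'$ with $p\lessdot p'$ is well defined and makes $P/G$ an $\overline\varepsilon$-consistent poset. If $Q$ is $\delta$-consistent, $(Q,\delta)$ is a saturation of $(P,\varepsilon)$ if $Q=P$ as sets; any $x,y$ with $|\rho_Q(y)-\rho_Q(x)|=1$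 are comparable in $Q$; $x<_P y$ implies $x<_Q y$; and $\rho_Q=\rho_P$. -}

module Defs where

open import Level using (0ℓ) renaming (suc to lsuc)
open import Data.Nat using (ℕ)
open import Data.Fin using (Fin)
open import Data.Sign using (Sign)
open import Data.Integer using (ℤ; _+_; _-_; ∣_∣; _◃_; 0ℤ)
open import Data.Product using (Σ; ∃; _×_; _,_)
open import Data.Sum using (_⊎_)
open import Relation.Nullary using (¬_)
open import Relation.Binary.Core using (Rel)
open import Relation.Binary.Definitions using (Decidable)
open import Relation.Binary.Structures using (IsPartialOrder; IsEquivalence)
open import Relation.Binary.Bundles using (Setoid)
open import Relation.Binary.PropositionalEquality using (_≡_; _≢_; refl; sym; trans)
open import Function.Base using (_∘_; id)
open import Function.Bundles using (_⇔_; Equivalence)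
open import Function.Definitions using (Bijective)

_<[_]_ : ∀ {n} → Fin n → Rel (Fin n) 0ℓ → Fin n → Set
x <[ R ] y = R x y × x ≢ y

_⋖[_]_ : ∀ {n} → Fin n → Rel (Fin n) 0ℓ → Fin n → Set
x ⋖[ R ] y = (x <[ R ] y) × (∀ z → ¬ ((x <[ R ] z) × (z <[ R ] y)))

-- an edge labeling: only its values on covering pairs are meaningful
Labeling : ℕ → Set
Labeling n = Fin n → Fin n → Sign

data SatChain {n} (R : Rel (Fin n) 0ℓ) : Fin n → Fin n → Set where
  [_]  : ∀ x → SatChain R x x
  _∷_ : ∀ {x y z} → x ⋖[ R ] y → SatChain R y z → SatChain R x z

weight : ∀ {n} {R : Rel (Fin n) 0ℓ} → Labeling n → ∀ {x y} → SatChain R x y → ℤ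
weight ε [ x ] = 0ℤ
weight ε (_∷_ {x} {y} _ c) = (ε x y ◃ 1) + weight ε c

-- x is minimal (in P, equivalently in P_{≤y} for any y ≥ x)
Minimal : ∀ {n} → Rel (Fin n) 0ℓ → Fin n → Set
Minimal R x = ∀ z → R z x → z ≡ x

-- a maximal saturated chain of P_{≤y}: from a minimal element up to y
record MaxChain {n} (R : Rel (Fin n) 0ℓ) (y : Fin n) : Set where
  constructor maxChain
  field
    bottom  : Fin n
    minimal : Minimal R bottom
    chain   : SatChain R bottom y

Consistent : ∀ {n} → Rel (Fin n) 0ℓ → Labeling n → Set
Consistent R ε = ∀ y (C D : MaxChain R y) →
  weight ε (MaxChain.chain C) ≡ weight ε (MaxChain.chain D)

-- "ρ(y) = r": some maximal chain of P_{≤y} has ε-value r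
-- (under consistency this value is independent of the chain)
HasRank : ∀ {n} → Rel (Fin n) 0ℓ → Labeling n → Fin n → ℤ → Set
HasRank R ε y r = Σ (MaxChain R y) λ C → weight ε (MaxChain.chain C) ≡ r

-- finite poset structure on Fin n (order decidable, as for any finite poset)
IsFinPoset : ∀ {n} → Rel (Fin n) 0ℓ → Set
IsFinPoset R = IsPartialOrder _≡_ R × Decidable R

record IsSaturation {n} (P : Rel (Fin n) 0ℓ) (ε : Labeling n)
                        (Q : Rel (Fin n) 0ℓ) (δ : Labeling n) : Set where
  field
    poset       : IsFinPoset Q
    consistent  : Consistent Q δ
    comparable  : ∀ x y rx ry → HasRank Q δ x rx → HasRank Q δ y ry →
                  ∣ ry - rx ∣ ≡ 1 → Q x y ⊎ Q y x
    extends     : ∀ x y → x <[ P ] y → x <[ Q ] y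
    sameRank    : ∀ y r → HasRank Q δ y r ⇔ HasRank P ε y r

record IsAut {n} (R : Rel (Fin n) 0ℓ) (ε : Labeling n) (ψ : Fin n → Fin n) : Set where
  field
    bijective  : Bijective _≡_ _≡_ ψ
    order      : ∀ x y → R x y ⇔ R (ψ x) (ψ y)
    label      : ∀ x y → x ⋖[ R ] y → ε (ψ x) (ψ y) ≡ ε x y

record Saturation {n} (P : Rel (Fin n) 0ℓ) (ε : Labeling n) : Set₁ where
  constructor sat
  field
    Q     : Rel (Fin n) 0ℓ
    δ     : Labeling n
    isSat : IsSaturation P ε Q δ

record InvSaturation {n} (P : Rel (Fin n) 0ℓ) (ε : Labeling n)
                         (G : (Fin n → Fin n) → Set) : Set₁ where
  constructor invSat
  field
    saturation : Saturation P ε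
    invariant  : ∀ g → G g → IsAut (Saturation.Q saturation) (Saturation.δ saturation) g

SameLabeledPoset : ∀ {n} → (Q : Rel (Fin n) 0ℓ) → Labeling n →
                   (Q′ : Rel (Fin n) 0ℓ) → Labeling n → Set
SameLabeledPoset Q δ Q′ δ′ =
  (∀ x y → Q x y ⇔ Q′ x y) × (∀ x y → x ⋖[ Q ] y → δ x y ≡ δ′ x y)

private
  ⇔-refl : ∀ {A : Set} → A ⇔ A
  ⇔-refl = record { to = id ; from = id ; to-cong = λ e → e ; from-cong = λ e → e }
  ⇔-sym : ∀ {A B : Set} → A ⇔ B → B ⇔ A
  ⇔-sym e = record { to = Equivalence.from e ; from = Equivalence.to e
                   ; to-cong = λ { refl → refl } ; from-cong = λ { refl → refl } }
  ⇔-trans : ∀ {A B C : Set} → A ⇔ B → B ⇔ C → A ⇔ C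
  ⇔-trans e f = record { to = Equivalence.to f ∘ Equivalence.to e
                       ; from = Equivalence.from e ∘ Equivalence.from f
                       ; to-cong = λ { refl → refl } ; from-cong = λ { refl → refl } }

  same-equiv : ∀ {n} → IsEquivalence {A = Σ (Rel (Fin n) 0ℓ) (λ _ → Labeling n)}
                        (λ { (Q , δ) (Q′ , δ′) → SameLabeledPoset Q δ Q′ δ′ })
  same-equiv = record
    { refl  = (λ x y → ⇔-refl) , (λ x y _ → refl)
    ; sym   = λ { (o , l) → (λ x y → ⇔-sym (o x y))
                , (λ x y ((q , ne) , mx) →
                     sym (l x y ((Equivalence.from (o x y) q , ne)
                       , λ z ((a , b) , (c , d)) →
                           mx z ((Equivalence.to (o x z) a , b) , (Equivalence.to (o z y) c , d))))) }
    ; trans = λ { (o , l) (o′ , l′) → (λ x y → ⇔-trans (o x y) (o′ x y))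
                , (λ x y cv@((q , ne) , mx) →
                     trans (l x y cv) (l′ x y ((Equivalence.to (o x y) q , ne)
                       , λ z ((a , b) , (c , d)) →
                           mx z ((Equivalence.from (o x z) a , b) , (Equivalence.from (o z y) c , d))))) }
    }

SaturationSetoid : ∀ {n} (P : Rel (Fin n) 0ℓ) (ε : Labeling n) → Setoid (lsuc 0ℓ) 0ℓ
SaturationSetoid P ε = record
  { Carrier = Saturation P ε
  ; _≈_ = λ S S′ → SameLabeledPoset (Saturation.Q S) (Saturation.δ S)
                                    (Saturation.Q S′) (Saturation.δ S′)
  ; isEquivalence = record
      { refl = IsEquivalence.refl same-equiv
      ; sym = IsEquivalence.sym same-equiv
      ; trans = IsEquivalence.trans same-equiv } }

InvSaturationSetoid : ∀ {n} (P : Rel (Fin n) 0ℓ) (ε : Labeling n)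
                      (G : (Fin n → Fin n) → Set) → Setoid (lsuc 0ℓ) 0ℓ
InvSaturationSetoid P ε G = record
  { Carrier = InvSaturation P ε G
  ; _≈_ = λ S S′ → let T = InvSaturation.saturation S ; T′ = InvSaturation.saturation S′ in
            SameLabeledPoset (Saturation.Q T) (Saturation.δ T) (Saturation.Q T′) (Saturation.δ T′)
  ; isEquivalence = record
      { refl = IsEquivalence.refl same-equiv
      ; sym = IsEquivalence.sym same-equiv
      ; trans = IsEquivalence.trans same-equiv } }

record IsAutSubgroup {n} (P : Rel (Fin n) 0ℓ) (ε : Labeling n)
                         (G : (Fin n → Fin n) → Set) : Set where
  field
    automorphism : ∀ g → G g → IsAut P ε g
    identity     : G id
    compose      : ∀ g h → G g → G h → G (g ∘ h)
    inverse      : ∀ g → G g → Σ (Fin n → Fin n) λ h → G h ×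
                     (∀ x → h (g x) ≡ x) × (∀ x → g (h x) ≡ x)

-- π : Fin n → Fin m presents Fin m as the set of G-orbits of Fin n
record IsOrbitMap {n m} (G : (Fin n → Fin n) → Set) (π : Fin n → Fin m) : Set where
  field
    surjective : ∀ (O : Fin m) → ∃ λ p → π p ≡ O
    fibres     : ∀ x y → (π x ≡ π y) ⇔ (∃ λ g → G g × g x ≡ y)

QuotientOrder : ∀ {n m} → Rel (Fin n) 0ℓ → (Fin n → Fin m) → Rel (Fin m) 0ℓ
QuotientOrder P π O O′ = ∃ λ p → ∃ λ p′ → π p ≡ O × π p′ ≡ O′ × P p p′

IsQuotientLabeling : ∀ {n m} → Rel (Fin n) 0ℓ → Labeling n → (Fin n → Fin m) →
                     Labeling m → Set
IsQuotientLabeling P ε π ε̄ = ∀ p p′ → p ⋖[ P ] p′ → ε̄ (π p) (π p′) ≡ ε p p′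

Rel′ : ℕ → Set₁
Rel′ n = Rel (Fin n) 0ℓ

-- A saturation Q̄ of P/G lifts to the saturation of P in which distinct elements of one
-- orbit are incomparable and elements of distinct orbits compare as their orbits do in Q̄,
-- with labels pulled back along the orbit map; it is G-invariant. Conversely a G-invariant
-- saturation Q descends to Q/G. Both constructions rest on two facts: G-orbits are antichains
-- (an automorphism of a finite poset cannot move an element strictly up), and in an invariant
-- saturation c ⋖ d implies c ≤ h d for every h ∈ G, because h d has rank one more than c.
-- Hence between two orbits the order of Q is all or nothing, and Q is the lift of Q/G.

module Submission where

open import Defs
open import Data.Nat using (ℕ)
open import Data.Fin using (Fin)
open import Data.Fin.Properties using (_≟_; any?)
open import Data.Fin.Induction using (po-wellFounded; po-noetherian)
open import Data.Sign using (Sign)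
open import Data.Integer using (ℤ; _+_; _-_; _◃_; ∣_∣)
import Data.Integer.Properties as ℤ
open import Algebra.Properties.AbelianGroup ℤ.+-0-abelianGroup using (∙-cancelˡ; xyx⁻¹≈y)
open import Data.Product using (Σ; ∃; _×_; _,_; proj₁; proj₂)
open import Data.Sum using (_⊎_; inj₁; inj₂)
open import Data.Empty using (⊥-elim)
open import Relation.Nullary using (¬_; Dec; yes; no)
open import Relation.Nullary.Decidable using (_×-dec_; _⊎-dec_; ¬?)
open import Relation.Binary.Bundles using (Setoid)
open import Relation.Binary.Structures using (IsPartialOrder)
open import Relation.Binary.PropositionalEquality
  using (_≡_; _≢_; refl; sym; trans; cong; cong₂; subst; subst₂; isEquivalence)
open import Induction.WellFounded using (Acc; acc)
open import Function.Bundles using (Bijection; _⇔_; mk⇔; Equivalence)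
open import Function.Definitions using (Bijective)
open import Function.Construct.Identity using (⇔-id)
open import Function.Construct.Symmetry using (⇔-sym)
open import Function.Construct.Composition using (_⇔-∘_)

+◃-cancelˡ : ∀ w {s t : Sign} → w + (s ◃ 1) ≡ w + (t ◃ 1) → s ≡ t
+◃-cancelˡ w e = ℤ.sign-cong (∙-cancelˡ w _ _ e)

∣[w+s◃1]-w∣≡1 : ∀ w (s : Sign) → ∣ (w + (s ◃ 1)) - w ∣ ≡ 1
∣[w+s◃1]-w∣≡1 w s = trans (cong ∣_∣ (xyx⁻¹≈y w (s ◃ 1))) (ℤ.abs-◃ s 1)

∣r-r∣≢1 : ∀ r → ∣ r - r ∣ ≢ 1
∣r-r∣≢1 r e with trans (sym (cong ∣_∣ (ℤ.+-inverseʳ r))) e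
... | ()

module Chains {n} {R : Rel′ n} where

  _∷ʳ_ : ∀ {x y z} → SatChain R x y → y ⋖[ R ] z → SatChain R x z
  [ _ ] ∷ʳ d = d ∷ [ _ ]
  (c ∷ C) ∷ʳ d = c ∷ (C ∷ʳ d)

  weight-∷ʳ : ∀ (ε : Labeling n) {x y z} (C : SatChain R x y) (d : y ⋖[ R ] z) →
              weight ε (C ∷ʳ d) ≡ weight ε C + (ε y z ◃ 1)
  weight-∷ʳ ε {y = y} {z} [ _ ] d = trans (ℤ.+-identityʳ (ε y z ◃ 1)) (sym (ℤ.+-identityˡ _))
  weight-∷ʳ ε (_∷_ {x} {w} _ C) d =
    trans (cong ((ε x w ◃ 1) +_) (weight-∷ʳ ε C d)) (sym (ℤ.+-assoc (ε x w ◃ 1) _ _))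

  module _ {ε : Labeling n} where

    hasRank-⋖ : ∀ {x y r} → HasRank R ε x r → x ⋖[ R ] y → HasRank R ε y (r + (ε x y ◃ 1))
    hasRank-⋖ (maxChain b m C , refl) d = maxChain b m (C ∷ʳ d) , weight-∷ʳ ε C d

    rank-unique : Consistent R ε → ∀ {y r r′} → HasRank R ε y r → HasRank R ε y r′ → r ≡ r′
    rank-unique con {y} (C , refl) (C′ , refl) = con y C C′

    rank-⋖ : Consistent R ε → ∀ {x y r r′} → HasRank R ε x r → HasRank R ε y r′ →
             x ⋖[ R ] y → r′ ≡ r + (ε x y ◃ 1)
    rank-⋖ con hx hy d = rank-unique con hy (hasRank-⋖ hx d)

module FinitePoset {n} {R : Rel′ n} (fp : IsFinPoset R) where
  open IsPartialOrder (proj₁ fp) public using (antisym) renaming (refl to ≤-refl; trans to ≤-trans)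
  open Chains {R = R}

  _<_ : Fin n → Fin n → Set
  x < y = x <[ R ] y

  ≤<-trans : ∀ {x y z} → R x y → y < z → x < z
  ≤<-trans x≤y (y≤z , y≢z) = ≤-trans x≤y y≤z , λ { refl → y≢z (antisym y≤z x≤y) }

  <-dec : ∀ x y → Dec (x < y)
  <-dec x y with proj₂ fp x y | x ≟ y
  ... | yes r | no x≢y = yes (r , x≢y)
  ... | yes _ | yes x≡y = no λ (_ , x≢y) → x≢y x≡y
  ... | no ¬r | _ = no λ (r , _) → ¬r r

  lowerCover : ∀ {y} z → z < y → ∃ λ c → R z c × c ⋖[ R ] y
  lowerCover z = go z (po-noetherian (proj₁ fp) z)
    where
      go : ∀ {y} z → Acc (λ a b → b < a) z → z < y → ∃ λ c → R z c × c ⋖[ R ] y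
      go {y} z (acc rs) z<y with any? (λ w → <-dec z w ×-dec <-dec w y)
      ... | no ∄w = z , ≤-refl , z<y , λ w p → ∄w (w , p)
      ... | yes (w , z<w , w<y) with go w (rs z<w) w<y
      ...   | c , w≤c , c⋖y = c , ≤-trans (proj₁ z<w) w≤c , c⋖y

  maxChain-exists : ∀ y → MaxChain R y
  maxChain-exists y = go y (po-wellFounded (proj₁ fp) y)
    where
      go : ∀ y → Acc _<_ y → MaxChain R y
      go y (acc rs) with any? (λ z → <-dec z y)
      ... | no ∄z = maxChain y minimal [ y ]
        where
          minimal : Minimal R y
          minimal z z≤y with z ≟ y
          ... | yes z≡y = z≡y
          ... | no z≢y = ⊥-elim (∄z (z , z≤y , z≢y))
      ... | yes (z , z<y) with lowerCover z z<y
      ...   | c , _ , c⋖y with go c (rs (proj₁ c⋖y))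
      ...     | maxChain b m C = maxChain b m (C ∷ʳ c⋖y)

  rank : Labeling n → Fin n → ℤ
  rank ε y = weight ε (MaxChain.chain (maxChain-exists y))

  hasRank-rank : ∀ ε y → HasRank R ε y (rank ε y)
  hasRank-rank ε y = maxChain-exists y , refl

  ⋖-label-by-rank : ∀ {ε} → Consistent R ε → ∀ {x y y′ r} → x ⋖[ R ] y → x ⋖[ R ] y′ →
                    HasRank R ε y r → HasRank R ε y′ r → ε x y ≡ ε x y′
  ⋖-label-by-rank {ε} con {x} x⋖y x⋖y′ hy hy′ =
    +◃-cancelˡ (rank ε x) (trans (sym (rank-⋖ con hx hy x⋖y)) (rank-⋖ con hx hy′ x⋖y′))
    where hx = hasRank-rank ε x

module Automorphism {n} {R : Rel′ n} {ε : Labeling n} {ψ : Fin n → Fin n} (aut : IsAut R ε ψ) where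
  open IsAut aut

  injective : ∀ {x y} → ψ x ≡ ψ y → x ≡ y
  injective = proj₁ bijective

  surjective : ∀ z → ∃ λ w → ψ w ≡ z
  surjective z with proj₂ bijective z
  ... | w , f = w , f refl

  mono : ∀ {x y} → R x y → R (ψ x) (ψ y)
  mono {x} {y} = Equivalence.to (order x y)

  reflects : ∀ {x y} → R (ψ x) (ψ y) → R x y
  reflects {x} {y} = Equivalence.from (order x y)

  <-mono : ∀ {x y} → x <[ R ] y → ψ x <[ R ] ψ y
  <-mono (r , x≢y) = mono r , λ e → x≢y (injective e)

  <-reflects : ∀ {x y} → ψ x <[ R ] ψ y → x <[ R ] y
  <-reflects (r , ψx≢ψy) = reflects r , λ { refl → ψx≢ψy refl }

  ⋖-mono : ∀ {x y} → x ⋖[ R ] y → ψ x ⋖[ R ] ψ y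
  ⋖-mono {x} {y} (x<y , nothing-between) = <-mono x<y , between
    where
      between : ∀ z → ¬ ((ψ x <[ R ] z) × (z <[ R ] ψ y))
      between z with surjective z
      ... | w , refl = λ (a , b) → nothing-between w (<-reflects a , <-reflects b)

  minimal-mono : ∀ {x} → Minimal R x → Minimal R (ψ x)
  minimal-mono {x} m z z≤ψx with surjective z
  ... | w , refl = cong ψ (m w (reflects z≤ψx))

  chain-map : ∀ {x y} (C : SatChain R x y) → Σ (SatChain R (ψ x) (ψ y)) λ D → weight ε D ≡ weight ε C
  chain-map [ x ] = [ ψ x ] , refl
  chain-map (_∷_ {x} {y} d C) with chain-map C
  ... | D , w = ⋖-mono d ∷ D , cong₂ _+_ (cong (_◃ 1) (label x y d)) w

  hasRank-mono : ∀ {y r} → HasRank R ε y r → HasRank R ε (ψ y) r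
  hasRank-mono (maxChain b m C , refl) with chain-map C
  ... | D , w = maxChain (ψ b) (minimal-mono m) D , w

  -- Otherwise x < ψ x < ψ (ψ x) < ⋯ would be an infinite chain in a finite poset.
  module _ (fp : IsFinPoset R) where
    open FinitePoset fp using (_<_)

    x≮ψx : ∀ x → ¬ (x < ψ x)
    x≮ψx x = go x (po-noetherian (proj₁ fp) x)
      where
        go : ∀ x → Acc (λ a b → b < a) x → ¬ (x < ψ x)
        go x (acc rs) x<ψx = go (ψ x) (rs x<ψx) (<-mono x<ψx)

    ψx≮x : ∀ x → ¬ (ψ x < x)
    ψx≮x x = go x (po-wellFounded (proj₁ fp) x)
      where
        go : ∀ x → Acc _<_ x → ¬ (ψ x < x)
        go x (acc rs) ψx<x = go (ψ x) (rs ψx<x) (<-mono ψx<x)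

module Orbits {n m} {R : Rel′ n} {ε : Labeling n} (fp : IsFinPoset R)
              {G : (Fin n → Fin n) → Set} (aut : ∀ g → G g → IsAut R ε g)
              {π : Fin n → Fin m} (orbits : IsOrbitMap G π) where
  open FinitePoset fp

  translate : ∀ {x y} → π x ≡ π y → ∃ λ g → G g × g x ≡ y
  translate {x} {y} = Equivalence.to (IsOrbitMap.fibres orbits x y)

  π-invariant : ∀ {g} → G g → ∀ x → π (g x) ≡ π x
  π-invariant {g} g∈G x = sym (Equivalence.from (IsOrbitMap.fibres orbits x (g x)) (g , g∈G , refl))

  mono : ∀ {g} → G g → ∀ {x y} → R x y → R (g x) (g y)
  mono g∈G = Automorphism.mono (aut _ g∈G)

  orbit-antichain : ∀ {x y} → R x y → π x ≡ π y → x ≡ y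
  orbit-antichain {x} x≤y πx≡πy with translate πx≡πy
  ... | g , g∈G , refl with x ≟ g x
  ...   | yes x≡gx = x≡gx
  ...   | no x≢gx = ⊥-elim (Automorphism.x≮ψx (aut g g∈G) fp x (x≤y , x≢gx))

  <⇒π≢ : ∀ {x y} → x < y → π x ≢ π y
  <⇒π≢ (x≤y , x≢y) πx≡πy = x≢y (orbit-antichain x≤y πx≡πy)

  quotient-isFinPoset : IsFinPoset (QuotientOrder R π)
  quotient-isFinPoset = record
    { isPreorder = record { isEquivalence = isEquivalence
                          ; reflexive = λ { {O} refl → q-refl O }
                          ; trans = q-trans }
    ; antisym = q-antisym } , q-dec
    where
      q-refl : ∀ O → QuotientOrder R π O O
      q-refl O with IsOrbitMap.surjective orbits O
      ... | p , πp≡O = p , p , πp≡O , πp≡O , ≤-refl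

      q-trans : ∀ {O O′ O″} → QuotientOrder R π O O′ → QuotientOrder R π O′ O″ →
                QuotientOrder R π O O″
      q-trans (p , p′ , πp , refl , p≤p′) (q , q′ , πq , πq′ , q≤q′) with translate πq
      ... | g , g∈G , refl =
        p , g q′ , πp , trans (π-invariant g∈G q′) πq′ , ≤-trans p≤p′ (mono g∈G q≤q′)

      q-antisym : ∀ {O O′} → QuotientOrder R π O O′ → QuotientOrder R π O′ O → O ≡ O′
      q-antisym (p , p′ , refl , refl , p≤p′) (q′ , q , πq′ , πq , q′≤q) with translate πq′
      ... | g , g∈G , refl = cong π (antisym p≤p′ (subst (R p′) (sym p≡gq) p′≤gq))
        where
          p′≤gq = mono g∈G q′≤q
          p≡gq = orbit-antichain (≤-trans p≤p′ p′≤gq) (sym (trans (π-invariant g∈G q) πq))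

      q-dec : ∀ O O′ → Dec (QuotientOrder R π O O′)
      q-dec O O′ = any? λ p → any? λ p′ → (π p ≟ O) ×-dec ((π p′ ≟ O′) ×-dec proj₂ fp p p′)

  -- R̄ need only be equivalent to the quotient order, so that this applies both to a
  -- saturation of P/G (via its lift) and to the quotient of an invariant saturation.
  module Projection {R̄ : Rel′ m} (fp̄ : IsFinPoset R̄)
                    (R̄⇔ : ∀ O O′ → R̄ O O′ ⇔ QuotientOrder R π O O′)
                    {ε̄ : Labeling m} (quotientLabel : IsQuotientLabeling R ε π ε̄) where

    π-mono : ∀ {x y} → R x y → R̄ (π x) (π y)
    π-mono {x} {y} x≤y = Equivalence.from (R̄⇔ (π x) (π y)) (x , y , refl , refl , x≤y)

    π-<-mono : ∀ {x y} → x < y → π x <[ R̄ ] π y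
    π-<-mono x<y = π-mono (proj₁ x<y) , <⇒π≢ x<y

    ⋖-lift : ∀ {O y} → O ⋖[ R̄ ] π y → ∃ λ x → π x ≡ O × x ⋖[ R ] y
    ⋖-lift {O} {y} ((O≤πy , O≢πy) , nothing-between) with Equivalence.to (R̄⇔ O (π y)) O≤πy
    ... | p , p′ , refl , πp′ , p≤p′ with translate πp′
    ...   | g , g∈G , refl = g p , πgp , (gp≤gp′ , gp≢gp′) , between
      where
        πgp = π-invariant g∈G p
        gp≤gp′ = mono g∈G p≤p′
        gp≢gp′ = λ e → O≢πy (trans (sym πgp) (cong π e))
        between : ∀ z → ¬ ((g p < z) × (z < g p′))
        between z (a , b) = nothing-between (π z) (subst (_<[ R̄ ] π z) πgp (π-<-mono a) , π-<-mono b)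

    chain-lift : ∀ {O O′} (C : SatChain R̄ O O′) y → π y ≡ O′ →
                 ∃ λ x → π x ≡ O × Σ (SatChain R x y) λ D → weight ε D ≡ weight ε̄ C
    chain-lift [ O ] y refl = y , refl , [ y ] , refl
    chain-lift (d ∷ C) y πy with chain-lift C y πy
    ... | x₁ , refl , D , w with ⋖-lift d
    ...   | x₀ , refl , e = x₀ , refl , e ∷ D , cong₂ _+_ (cong (_◃ 1) (sym (quotientLabel x₀ x₁ e))) w

    minimal-lift : ∀ {x} → Minimal R̄ (π x) → Minimal R x
    minimal-lift m z z≤x = orbit-antichain z≤x (m (π z) (π-mono z≤x))

    hasRank-lift : ∀ {y O r} → π y ≡ O → HasRank R̄ ε̄ O r → HasRank R ε y r
    hasRank-lift {y} πy (maxChain _ m C , w) with chain-lift C y πy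
    ... | x , refl , D , wD = maxChain x (minimal-lift m) D , trans wD w

    hasRank-proj : Consistent R ε → ∀ {y O r} → π y ≡ O → HasRank R ε y r → HasRank R̄ ε̄ O r
    hasRank-proj con {y} {O} πy (C , wC) with FinitePoset.maxChain-exists fp̄ O
    ... | C̄@(maxChain _ m C̄′) with chain-lift C̄′ y πy
    ...   | x , refl , D , wD = C̄ , trans (sym wD) (trans (con y (maxChain x (minimal-lift m) D) C) wC)

    consistent-proj : Consistent R ε → Consistent R̄ ε̄
    consistent-proj con O (maxChain _ m₁ C₁) (maxChain _ m₂ C₂) with IsOrbitMap.surjective orbits O
    ... | y , πy with chain-lift C₁ y πy | chain-lift C₂ y πy
    ...   | x₁ , refl , D₁ , w₁ | x₂ , refl , D₂ , w₂ =
      trans (sym w₁) (trans (con y (maxChain x₁ (minimal-lift m₁) D₁) (maxChain x₂ (minimal-lift m₂) D₂))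
                            w₂)

LiftOrder : ∀ {n m} → (Fin n → Fin m) → Rel′ m → Rel′ n
LiftOrder π Q̄ x y = x ≡ y ⊎ (π x <[ Q̄ ] π y)

liftLabeling : ∀ {n m} → (Fin n → Fin m) → Labeling m → Labeling n
liftLabeling π δ̄ x y = δ̄ (π x) (π y)

⋖-cong : ∀ {n} {R₁ R₂ : Rel′ n} → (∀ x y → R₁ x y ⇔ R₂ x y) → ∀ {x y} → x ⋖[ R₁ ] y → x ⋖[ R₂ ] y
⋖-cong R₁⇔R₂ {x} {y} ((x≤y , x≢y) , nothing-between) =
  (Equivalence.to (R₁⇔R₂ x y) x≤y , x≢y) ,
  λ z ((x≤z , x≢z) , (z≤y , z≢y)) →
    nothing-between z ((Equivalence.from (R₁⇔R₂ x z) x≤z , x≢z) ,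
                       (Equivalence.from (R₁⇔R₂ z y) z≤y , z≢y))

LiftOrder-cong : ∀ {n m} (π : Fin n → Fin m) {Q̄₁ Q̄₂ : Rel′ m} → (∀ O O′ → Q̄₁ O O′ ⇔ Q̄₂ O O′) →
                 ∀ x y → LiftOrder π Q̄₁ x y ⇔ LiftOrder π Q̄₂ x y
LiftOrder-cong π Q̄₁⇔Q̄₂ x y = mk⇔ (transfer Q̄₁⇔Q̄₂) (transfer (λ O O′ → ⇔-sym (Q̄₁⇔Q̄₂ O O′)))
  where
    transfer : ∀ {A B} → (∀ O O′ → A O O′ ⇔ B O O′) → LiftOrder π A x y → LiftOrder π B x y
    transfer A⇔B (inj₁ x≡y) = inj₁ x≡y
    transfer A⇔B (inj₂ (a , πx≢πy)) = inj₂ (Equivalence.to (A⇔B (π x) (π y)) a , πx≢πy)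

QuotientOrder-cong : ∀ {n m} (π : Fin n → Fin m) {R₁ R₂ : Rel′ n} → (∀ x y → R₁ x y ⇔ R₂ x y) →
                     ∀ O O′ → QuotientOrder R₁ π O O′ ⇔ QuotientOrder R₂ π O O′
QuotientOrder-cong π R₁⇔R₂ O O′ =
  mk⇔ (λ (p , p′ , πp , πp′ , r) → p , p′ , πp , πp′ , Equivalence.to (R₁⇔R₂ p p′) r)
      (λ (p , p′ , πp , πp′ , r) → p , p′ , πp , πp′ , Equivalence.from (R₁⇔R₂ p p′) r)

module LiftOrderProperties {n m} {Q̄ : Rel′ m} (fp̄ : IsFinPoset Q̄)
                           {π : Fin n → Fin m} (surjective : ∀ O → ∃ λ p → π p ≡ O) where
  open FinitePoset fp̄ using (≤-refl; ≤-trans; antisym)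

  Q : Rel′ n
  Q = LiftOrder π Q̄

  isFinPoset : IsFinPoset Q
  isFinPoset = record
    { isPreorder = record { isEquivalence = isEquivalence
                          ; reflexive = λ { refl → inj₁ refl }
                          ; trans = Q-trans }
    ; antisym = Q-antisym } , Q-dec
    where
      Q-trans : ∀ {x y z} → Q x y → Q y z → Q x z
      Q-trans (inj₁ refl) y≤z = y≤z
      Q-trans x≤y (inj₁ refl) = x≤y
      Q-trans {x} {y} {z} (inj₂ (a , πx≢πy)) (inj₂ (b , _)) =
        inj₂ (≤-trans a b , λ { πx≡πz → πx≢πy (antisym a (subst (Q̄ (π y)) (sym πx≡πz) b)) })

      Q-antisym : ∀ {x y} → Q x y → Q y x → x ≡ y
      Q-antisym (inj₁ x≡y) _ = x≡y
      Q-antisym (inj₂ _) (inj₁ y≡x) = sym y≡x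
      Q-antisym (inj₂ (a , πx≢πy)) (inj₂ (b , _)) = ⊥-elim (πx≢πy (antisym a b))

      Q-dec : ∀ x y → Dec (Q x y)
      Q-dec x y = (x ≟ y) ⊎-dec (proj₂ fp̄ (π x) (π y) ×-dec ¬? (π x ≟ π y))

  Q̄⇔quotient : ∀ O O′ → Q̄ O O′ ⇔ QuotientOrder Q π O O′
  Q̄⇔quotient O O′ = mk⇔ to from
    where
      to : Q̄ O O′ → QuotientOrder Q π O O′
      to a with surjective O | surjective O′ | O ≟ O′
      ... | p , πp | _ , _ | yes O≡O′ = p , p , πp , trans πp O≡O′ , inj₁ refl
      ... | p , refl | p′ , refl | no O≢O′ = p , p′ , refl , refl , inj₂ (a , O≢O′)
      from : QuotientOrder Q π O O′ → Q̄ O O′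
      from (_ , _ , refl , refl , inj₁ refl) = ≤-refl
      from (_ , _ , refl , refl , inj₂ (a , _)) = a

  isAut : ∀ {δ̄ : Labeling m} {g} → Bijective _≡_ _≡_ g → (∀ x → π (g x) ≡ π x) →
          IsAut Q (liftLabeling π δ̄) g
  isAut {δ̄} {g} bij πg≡π = record
    { bijective = bij
    ; order = λ x y → mk⇔ (to x y) (from x y)
    ; label = λ x y _ → cong₂ δ̄ (πg≡π x) (πg≡π y) }
    where
      to : ∀ x y → Q x y → Q (g x) (g y)
      to x y (inj₁ x≡y) = inj₁ (cong g x≡y)
      to x y (inj₂ (a , πx≢πy)) =
        inj₂ (subst₂ Q̄ (sym (πg≡π x)) (sym (πg≡π y)) a ,
              λ e → πx≢πy (trans (sym (πg≡π x)) (trans e (πg≡π y))))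
      from : ∀ x y → Q (g x) (g y) → Q x y
      from x y (inj₁ gx≡gy) = inj₁ (proj₁ bij gx≡gy)
      from x y (inj₂ (a , πgx≢πgy)) =
        inj₂ (subst₂ Q̄ (πg≡π x) (πg≡π y) a ,
              λ e → πgx≢πgy (trans (πg≡π x) (trans e (sym (πg≡π y)))))

  ⋖-proj : ∀ {x y} → x ⋖[ Q ] y → π x ⋖[ Q̄ ] π y
  ⋖-proj ((inj₁ x≡y , x≢y) , _) = ⊥-elim (x≢y x≡y)
  ⋖-proj {x} {y} ((inj₂ πx<πy , _) , nothing-between) = πx<πy , between
    where
      lift< : ∀ {u v} → π u <[ Q̄ ] π v → u <[ Q ] v
      lift< πu<πv = inj₂ πu<πv , λ u≡v → proj₂ πu<πv (cong π u≡v)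
      between : ∀ O → ¬ ((π x <[ Q̄ ] O) × (O <[ Q̄ ] π y))
      between O with surjective O
      ... | z , refl = λ (a , b) → nothing-between z (lift< a , lift< b)

  module _ {δ̄ : Labeling m} where

    chain-proj : ∀ {x y} (C : SatChain Q x y) →
                 Σ (SatChain Q̄ (π x) (π y)) λ D → weight δ̄ D ≡ weight (liftLabeling π δ̄) C
    chain-proj [ x ] = [ π x ] , refl
    chain-proj (_∷_ {x} {y} d C) with chain-proj C
    ... | D , w = ⋖-proj d ∷ D , cong ((δ̄ (π x) (π y) ◃ 1) +_) w

    minimal-proj : ∀ {x} → Minimal Q x → Minimal Q̄ (π x)
    minimal-proj {x} m O O≤πx with O ≟ π x
    ... | yes O≡πx = O≡πx
    ... | no O≢πx with surjective O
    ...   | z , refl = ⊥-elim (O≢πx (cong π (m z (inj₂ (O≤πx , O≢πx)))))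

    consistent-lift : Consistent Q̄ δ̄ → Consistent Q (liftLabeling π δ̄)
    consistent-lift con y (maxChain b₁ m₁ C₁) (maxChain b₂ m₂ C₂) with chain-proj C₁ | chain-proj C₂
    ... | D₁ , w₁ | D₂ , w₂ =
      trans (sym w₁) (trans (con (π y) (maxChain _ (minimal-proj m₁) D₁) (maxChain _ (minimal-proj m₂) D₂))
                            w₂)

module Correspondence {n m} {P : Rel′ n} {ε : Labeling n} (fpP : IsFinPoset P) (conP : Consistent P ε)
                      {G : (Fin n → Fin n) → Set} (subgroup : IsAutSubgroup P ε G)
                      {π : Fin n → Fin m} (orbits : IsOrbitMap G π)
                      {ε̄ : Labeling m} (quotientLabel : IsQuotientLabeling P ε π ε̄) where

  P/G : Rel′ m
  P/G = QuotientOrder P π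

  private
    autP = IsAutSubgroup.automorphism subgroup
    module OP = Orbits fpP autP orbits
    module P↠P/G = OP.Projection OP.quotient-isFinPoset (λ _ _ → ⇔-id _) {ε̄ = ε̄} quotientLabel

  module Lift (S̄ : Saturation P/G ε̄) where
    open Saturation S̄ renaming (Q to Q̄; δ to δ̄; isSat to isSat̄)
    open LiftOrderProperties (IsSaturation.poset isSat̄) (IsOrbitMap.surjective orbits) public
    open Chains {R = Q}

    δ : Labeling n
    δ = liftLabeling π δ̄

    conQ : Consistent Q δ
    conQ = consistent-lift {δ̄ = δ̄} (IsSaturation.consistent isSat̄)

    invariant : ∀ g → G g → IsAut Q δ g
    invariant g g∈G = isAut {δ̄ = δ̄} (IsAut.bijective (autP g g∈G)) (OP.π-invariant g∈G)

    module Q↠Q̄ = Orbits.Projection isFinPoset invariant orbits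
                   (IsSaturation.poset isSat̄) Q̄⇔quotient {ε̄ = δ̄} (λ _ _ _ → refl)

    comparable : ∀ x y rx ry → HasRank Q δ x rx → HasRank Q δ y ry → ∣ ry - rx ∣ ≡ 1 → Q x y ⊎ Q y x
    comparable x y rx ry hx hy d with π x ≟ π y
    ... | yes πx≡πy = ⊥-elim (∣r-r∣≢1 rx (subst (λ r → ∣ r - rx ∣ ≡ 1) (sym rx≡ry) d))
      where rx≡ry = rank-unique conQ hx (Q↠Q̄.hasRank-lift πx≡πy (Q↠Q̄.hasRank-proj conQ refl hy))
    ... | no πx≢πy with IsSaturation.comparable isSat̄ (π x) (π y) rx ry
                          (Q↠Q̄.hasRank-proj conQ refl hx) (Q↠Q̄.hasRank-proj conQ refl hy) d
    ...   | inj₁ πx≤πy = inj₁ (inj₂ (πx≤πy , πx≢πy))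
    ...   | inj₂ πy≤πx = inj₂ (inj₂ (πy≤πx , λ e → πx≢πy (sym e)))

    extends : ∀ x y → x <[ P ] y → x <[ Q ] y
    extends x y x<y = inj₂ (IsSaturation.extends isSat̄ (π x) (π y) (P↠P/G.π-<-mono x<y)) , proj₂ x<y

    sameRank : ∀ y r → HasRank Q δ y r ⇔ HasRank P ε y r
    sameRank y r = mk⇔
      (λ h → P↠P/G.hasRank-lift refl (Equivalence.to Q̄≈P/G (Q↠Q̄.hasRank-proj conQ refl h)))
      (λ h → Q↠Q̄.hasRank-lift refl (Equivalence.from Q̄≈P/G (P↠P/G.hasRank-proj conP refl h)))
      where Q̄≈P/G = IsSaturation.sameRank isSat̄ (π y) r

    invSaturation : InvSaturation P ε G
    invSaturation = invSat (sat Q δ record { poset = isFinPoset ; consistent = conQ ; comparable = comparable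
                                           ; extends = extends ; sameRank = sameRank })
                           invariant

  module Descend (T : InvSaturation P ε G) where
    open InvSaturation T
    open Saturation saturation
    open FinitePoset (IsSaturation.poset isSat)
    open Chains {R = Q}
    open Orbits (IsSaturation.poset isSat) invariant orbits

    conQ : Consistent Q δ
    conQ = IsSaturation.consistent isSat

    -- h d has the rank of d, one more than that of c, so c and h d are comparable;
    -- and h d ≤ c would give h d < d, impossible for an automorphism.
    ⋖⇒≤-translate : ∀ {c d h} → c ⋖[ Q ] d → G h → Q c (h d)
    ⋖⇒≤-translate {c} {d} {h} c⋖d h∈G
      with IsSaturation.comparable isSat c (h d) _ _ (hasRank-rank δ c) hd-rank
             (∣[w+s◃1]-w∣≡1 (rank δ c) (δ c d))
      where hd-rank = Automorphism.hasRank-mono (invariant h h∈G) (hasRank-⋖ (hasRank-rank δ c) c⋖d)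
    ... | inj₁ c≤hd = c≤hd
    ... | inj₂ hd≤c =
      ⊥-elim (Automorphism.ψx≮x (invariant h h∈G) (IsSaturation.poset isSat) d (≤<-trans hd≤c (proj₁ c⋖d)))

    orbit-≤ : ∀ {x y x′ y′} → x < y → π x′ ≡ π x → π y′ ≡ π y → Q x′ y′
    orbit-≤ {x} {y} x<y πx′ πy′ with translate (sym πx′)
    ... | g , g∈G , refl with translate (trans (π-invariant g∈G y) (sym πy′))
    ...   | h , h∈G , refl with lowerCover (g x) (Automorphism.<-mono (invariant g g∈G) x<y)
    ...     | c , gx≤c , c⋖gy = ≤-trans gx≤c (⋖⇒≤-translate c⋖gy h∈G)

    orbit-< : ∀ {x y x′ y′} → x < y → π x′ ≡ π x → π y′ ≡ π y → x′ < y′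
    orbit-< x<y πx′ πy′ = orbit-≤ x<y πx′ πy′ , λ { refl → <⇒π≢ x<y (trans (sym πx′) πy′) }

    orbit-⋖ : ∀ {x y x′ y′} → x ⋖[ Q ] y → π x′ ≡ π x → π y′ ≡ π y → x′ ⋖[ Q ] y′
    orbit-⋖ (x<y , nothing-between) πx′ πy′ =
      orbit-< x<y πx′ πy′ ,
      λ z (x′<z , z<y′) → nothing-between z (orbit-< x′<z (sym πx′) refl , orbit-< z<y′ refl (sym πy′))

    -- With g x = x′ and h (g y) = y′, the covers g x ⋖ g y and x′ ⋖ y′ have tops of equal rank.
    orbit-label : ∀ {x y x′ y′} → x ⋖[ Q ] y → x′ ⋖[ Q ] y′ → π x′ ≡ π x → π y′ ≡ π y → δ x y ≡ δ x′ y′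
    orbit-label {x} {y} {y′ = y′} x⋖y x′⋖y′ πx′ πy′ with translate (sym πx′)
    ... | g , g∈G , refl with translate (trans (π-invariant g∈G y) (sym πy′))
    ...   | h , h∈G , refl =
      trans (sym (IsAut.label (invariant g g∈G) x y x⋖y))
            (⋖-label-by-rank conQ gx⋖gy x′⋖y′ hgy (Automorphism.hasRank-mono (invariant h h∈G) hgy))
      where
        gx⋖gy = Automorphism.⋖-mono (invariant g g∈G) x⋖y
        hgy = hasRank-rank δ (g y)

    representative : Fin m → Fin n
    representative O = proj₁ (IsOrbitMap.surjective orbits O)

    π-representative : ∀ O → π (representative O) ≡ O
    π-representative O = proj₂ (IsOrbitMap.surjective orbits O)

    Q̄ : Rel′ m
    Q̄ = QuotientOrder Q π

    δ̄ : Labeling m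
    δ̄ O O′ = δ (representative O) (representative O′)

    quotientLabelQ : IsQuotientLabeling Q δ π δ̄
    quotientLabelQ x y x⋖y = sym (orbit-label x⋖y (orbit-⋖ x⋖y (π-representative _) (π-representative _))
                                               (π-representative _) (π-representative _))

    module Q↠Q̄ = Projection quotient-isFinPoset (λ _ _ → ⇔-id _) {ε̄ = δ̄} quotientLabelQ

    comparable : ∀ O O′ rO rO′ → HasRank Q̄ δ̄ O rO → HasRank Q̄ δ̄ O′ rO′ → ∣ rO′ - rO ∣ ≡ 1 →
                 Q̄ O O′ ⊎ Q̄ O′ O
    comparable O O′ rO rO′ hO hO′ d
      with IsSaturation.comparable isSat (representative O) (representative O′) rO rO′
             (Q↠Q̄.hasRank-lift (π-representative O) hO) (Q↠Q̄.hasRank-lift (π-representative O′) hO′) d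
    ... | inj₁ q = inj₁ (_ , _ , π-representative O , π-representative O′ , q)
    ... | inj₂ q = inj₂ (_ , _ , π-representative O′ , π-representative O , q)

    extends : ∀ O O′ → O <[ P/G ] O′ → O <[ Q̄ ] O′
    extends O O′ ((p , p′ , πp , πp′ , p≤p′) , O≢O′) =
      (p , p′ , πp , πp′ , proj₁ (IsSaturation.extends isSat p p′ (p≤p′ , p≢p′))) , O≢O′
      where p≢p′ = λ { refl → O≢O′ (trans (sym πp) πp′) }

    sameRank : ∀ O r → HasRank Q̄ δ̄ O r ⇔ HasRank P/G ε̄ O r
    sameRank O r = mk⇔
      (λ h → P↠P/G.hasRank-proj conP (π-representative O)
               (Equivalence.to (IsSaturation.sameRank isSat _ r) (Q↠Q̄.hasRank-lift (π-representative O) h)))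
      (λ h → Q↠Q̄.hasRank-proj conQ (π-representative O)
               (Equivalence.from (IsSaturation.sameRank isSat _ r) (P↠P/G.hasRank-lift (π-representative O) h)))

    saturation̄ : Saturation P/G ε̄
    saturation̄ = sat Q̄ δ̄ record { poset = quotient-isFinPoset ; consistent = Q↠Q̄.consistent-proj conQ
                                ; comparable = comparable ; extends = extends ; sameRank = sameRank }

    liftOrder⇔ : ∀ x y → LiftOrder π Q̄ x y ⇔ Q x y
    liftOrder⇔ x y = mk⇔ to from
      where
        to : LiftOrder π Q̄ x y → Q x y
        to (inj₁ refl) = ≤-refl
        to (inj₂ ((p , p′ , πp , πp′ , p≤p′) , πx≢πy)) = orbit-≤ (p≤p′ , p≢p′) (sym πp) (sym πp′)
          where p≢p′ = λ { refl → πx≢πy (trans (sym πp) πp′) }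
        from : Q x y → LiftOrder π Q̄ x y
        from x≤y with x ≟ y
        ... | yes x≡y = inj₁ x≡y
        ... | no x≢y = inj₂ ((x , y , refl , refl , x≤y) , <⇒π≢ (x≤y , x≢y))

    lift-descend : SameLabeledPoset (LiftOrder π Q̄) (liftLabeling π δ̄) Q δ
    lift-descend = liftOrder⇔ , λ x y x⋖y → quotientLabelQ x y (⋖-cong liftOrder⇔ x⋖y)

  open Setoid (SaturationSetoid P/G ε̄) using () renaming (_≈_ to _≈̄_)
  open Setoid (InvSaturationSetoid P ε G) using (_≈_) renaming (trans to ≈-trans)

  lift : Saturation P/G ε̄ → InvSaturation P ε G
  lift = Lift.invSaturation

  lift-cong : ∀ {S₁ S₂} → S₁ ≈̄ S₂ → lift S₁ ≈ lift S₂
  lift-cong {S₁} (Q̄₁⇔Q̄₂ , same-label) =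
    LiftOrder-cong π Q̄₁⇔Q̄₂ , λ x y x⋖y → same-label (π x) (π y) (Lift.⋖-proj S₁ x⋖y)

  lift-injective : ∀ {S₁ S₂} → lift S₁ ≈ lift S₂ → S₁ ≈̄ S₂
  lift-injective {S₁} {S₂} (Q₁⇔Q₂ , same-label) = order , label
    where
      order : ∀ O O′ → Saturation.Q S₁ O O′ ⇔ Saturation.Q S₂ O O′
      order O O′ = ⇔-sym (Lift.Q̄⇔quotient S₂ O O′)
                   ⇔-∘ (QuotientOrder-cong π Q₁⇔Q₂ O O′ ⇔-∘ Lift.Q̄⇔quotient S₁ O O′)
      label : ∀ O O′ → O ⋖[ Saturation.Q S₁ ] O′ → Saturation.δ S₁ O O′ ≡ Saturation.δ S₂ O O′
      label O O′ O⋖O′ with IsOrbitMap.surjective orbits O′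
      ... | y , refl with Lift.Q↠Q̄.⋖-lift S₁ O⋖O′
      ...   | x , refl , x⋖y = same-label x y x⋖y

  lift-surjective : ∀ T → ∃ λ S̄ → ∀ {Z} → Z ≈̄ S̄ → lift Z ≈ T
  lift-surjective T = S̄ , λ {Z} Z≈S̄ → ≈-trans {lift Z} {lift S̄} {T} (lift-cong {Z} {S̄} Z≈S̄) (Descend.lift-descend T)
    where S̄ = Descend.saturation̄ T

  bijection : Bijection (SaturationSetoid P/G ε̄) (InvSaturationSetoid P ε G)
  bijection = record { to = lift ; cong = λ {S₁} {S₂} → lift-cong {S₁} {S₂}
                   ; bijective = (λ {S₁} {S₂} → lift-injective {S₁} {S₂}) , lift-surjective }

lemma2p12 : ∀ {n} (P : Rel′ n) (ε : Labeling n) →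
            IsFinPoset P → Consistent P ε →
            (G : (Fin n → Fin n) → Set) → IsAutSubgroup P ε G →
            (m : ℕ) (π : Fin n → Fin m) → IsOrbitMap G π →
            (ε̄ : Labeling m) → IsQuotientLabeling P ε π ε̄ →
            Bijection (SaturationSetoid (QuotientOrder P π) ε̄)
                      (InvSaturationSetoid P ε G)
lemma2p12 P ε fpP conP G subgroup m π orbits ε̄ quotientLabel =
  Correspondence.bijection fpP conP subgroup orbits quotientLabel
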